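{- Let $N_d(n)$ be the number of $d$-dimensional simplices of $\mathcal{K}(n)$ in the DSC process. Then $N_n(n)=1$ for all $n\ge 0$, and $$N_{n-1}(n)=\binom{n}{1}\frac{n+3}{2}\quad(n\ge1),\qquad N_{n-2}(n)=\binom{n}{2}\frac{(n+1)(3n+14)}{12}\quad(n\ge2),$$ $$N_{n-3}(n)=\binom{n}{3}\frac{n^3+8n^2+11n-4}{8}\quad(n\ge3).$$
   Context: The DSC process: $\mathcal{K}(0)$ consists of a single vertex. For $n\ge 1$, $\mathcal{K}(n)$ is obtained from $\mathcal{K}(n-1)$ by adding, for every simplex $\sigma$ of $\mathcal{K}(n-1)$ (of every dimension, vertices included), a new vertex $w_\sigma$ together with the simplex $\sigma\cup\{w_\sigma\}$ and all its faces (distinct simplices receive distinct new vertices). Vertices count as $0$-dimensional simplices. -}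

module Defs where

open import Data.Nat using (ℕ; zero; suc; _+_)
import Data.Nat as Nat
open import Data.List using (List; []; _∷_; _++_; [_]; length; filter; deduplicate; map)
open import Data.List.Properties using (≡-dec)
open import Data.Product using (_×_; _,_; proj₁; proj₂)
open import Data.Unit using (⊤; tt)
open import Data.Empty using (⊥)
open import Relation.Nullary using (Dec; yes; no)
open import Relation.Binary.PropositionalEquality using (_≡_)

-- A simplex is represented by the list of its vertex labels (natural numbers),
-- kept in strictly increasing order (this invariant is preserved by the
-- construction below: new vertices always get labels larger than all old ones,
-- and faces are taken as subsequences), so list equality = set equality.
Simplex : Set
Simplex = List ℕ

sublists : List ℕ → List (List ℕ)
sublists [] = [] ∷ []
sublists (x ∷ xs) = map (x ∷_) (sublists xs) ++ sublists xs

NonNil : List ℕ → Set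
NonNil [] = ⊥
NonNil (_ ∷ _) = ⊤

nonNil? : (τ : List ℕ) → Dec (NonNil τ)
nonNil? [] = no (λ ())
nonNil? (_ ∷ _) = yes tt

faces : Simplex → List Simplex
faces σ = filter nonNil? (sublists σ)

-- For each simplex σ of the list (in order), a new vertex with label m, m+1, ...
-- (distinct simplices get distinct new vertices), and we add σ ∪ {w_σ}
-- together with all its faces.
coneAll : ℕ → List Simplex → List Simplex
coneAll m [] = []
coneAll m (σ ∷ S) = faces (σ ++ [ m ]) ++ coneAll (suc m) S

-- A stage of the process: the list of simplices (without repetition) and the
-- next unused vertex label.
State : Set
State = List Simplex × ℕ

step : State → State
step (S , m) = deduplicate (≡-dec Nat._≟_) (S ++ coneAll m S) , m + length S

K : ℕ → State
K zero = ([ [ 0 ] ] , 1)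
K (suc n) = step (K n)

simplices : ℕ → List Simplex
simplices n = proj₁ (K n)

N : ℕ → ℕ → ℕ
N d n = length (filter (λ σ → length σ Nat.≟ suc d) (simplices n))

-- Each simplex σ of K(n) receives a fresh vertex w_σ, and the simplices of K(n+1) are those of
-- K(n) together with the τ ∪ {w_σ} for all faces τ ⊆ σ, the empty face included, all distinct.
-- Counting the latter by size gives N_d(n+1) = N_d(n) + Σ_{σ ∈ K(n)} C(|σ|, d).  As a simplex of
-- K(n) has at most n + 1 vertices, for d = m + 1 and n = j + m only the counts N_{t+m}(j+m),
-- t ≤ j, of codimension at most j enter the sum.  So the codimension-j counts obey a recurrence
-- in m driven by the lower codimensions, against which the stated polynomials are checked by
-- induction for j = 0, 1, 2, 3.  On the list model, the deduplication in step is harmless because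
-- K(n) has no repeated simplices, no repeated vertices within a simplex, only vertices below the
-- next fresh label, and is closed under nonempty faces; step preserves these properties.

module Submission where

open import Defs
open import Function using (_∘_)
open import Data.Bool using (true; false; T; if_then_else_)
open import Data.Empty using (⊥-elim)
open import Data.Unit using (tt)
open import Data.Product using (_×_; _,_; proj₁; proj₂; ∃)
open import Data.Sum as Sum using (_⊎_; inj₁; inj₂)
open import Data.Nat using (ℕ; zero; suc; _+_; _*_; _∸_; _^_; _≤_; _<_; _≡ᵇ_; _≟_; z≤n; s≤s)
open import Data.Nat.Properties
open import Data.Nat.Combinatorics
  using (_C_; nCn≡1; nC1≡n; nCk≡nC[n∸k]; nCk+nC[k+1]≡[n+1]C[k+1]; k>n⇒nCk≡0)
open import Data.Nat.Tactic.RingSolver using (solve; solve-∀)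
open import Algebra.Properties.CommutativeSemigroup +-commutativeSemigroup
  using () renaming (interchange to +-interchange)
open import Data.List using (List; []; _∷_; _++_; [_]; _∷ʳ_; length; filter; map)
open import Data.Nat.ListAction using (sum)
open import Data.List.Properties using (≡-dec; length-++; filter-++; ∷-injectiveʳ; ∷ʳ-injectiveˡ; ∷ʳ-injectiveʳ)
open import Data.List.Membership.Propositional using (_∈_; _∉_)
open import Data.List.Membership.Propositional.Properties
  using (∈-++⁺ˡ; ∈-++⁺ʳ; ∈-++⁻; ∈-map⁺; ∈-map⁻; ∈-filter⁺; ∈-filter⁻; ∈-deduplicate⁺; ∈-deduplicate⁻)
open import Data.List.Relation.Unary.Any using (here; there)
open import Data.List.Relation.Unary.All as All using (All; []; _∷_)
import Data.List.Relation.Unary.All.Properties as All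
open import Data.List.Relation.Unary.AllPairs using ([]; _∷_)
open import Data.List.Relation.Unary.Unique.Propositional using (Unique)
import Data.List.Relation.Unary.Unique.Propositional.Properties as Unique
open import Data.List.Relation.Unary.Unique.DecPropositional.Properties (≡-dec _≟_) using (deduplicate-!)
open import Data.List.Relation.Binary.Disjoint.Propositional using (Disjoint)
open import Data.List.Relation.Binary.Permutation.Propositional using (_↭_; ↭-sym)
open import Data.List.Relation.Binary.Permutation.Propositional.Properties using (∈-resp-↭; filter-↭; ↭-length)
open import Data.List.Membership.Propositional.Properties.WithK using (unique∧set⇒bag)
open import Data.List.Relation.Binary.BagAndSetEquality using (∼bag⇒↭)
open import Function.Bundles using (mk⇔)
open import Relation.Nullary using (contradiction)
open import Relation.Binary.PropositionalEquality
  using (_≡_; _≢_; refl; sym; trans; cong; cong₂; subst; module ≡-Reasoning)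

open ≡-Reasoning

infix 4 _⊑_

_⊑_ : List ℕ → List ℕ → Set
τ ⊑ σ = τ ∈ sublists σ

⊑-∈ : ∀ σ {τ y} → τ ⊑ σ → y ∈ τ → y ∈ σ
⊑-∈ [] (here refl) ()
⊑-∈ (x ∷ σ) p q with ∈-++⁻ (map (x ∷_) (sublists σ)) p
... | inj₂ τ⊑σ = there (⊑-∈ σ τ⊑σ q)
... | inj₁ r with ∈-map⁻ (x ∷_) r
... | _ , τ⊑σ , refl with q
...   | here y≡x = here y≡x
...   | there y∈τ = there (⊑-∈ σ τ⊑σ y∈τ)

⊑-length : ∀ σ {τ} → τ ⊑ σ → length τ ≤ length σ
⊑-length [] (here refl) = z≤n
⊑-length (x ∷ σ) p with ∈-++⁻ (map (x ∷_) (sublists σ)) p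
... | inj₂ τ⊑σ = m≤n⇒m≤1+n (⊑-length σ τ⊑σ)
... | inj₁ r with ∈-map⁻ (x ∷_) r
... | _ , τ⊑σ , refl = s≤s (⊑-length σ τ⊑σ)

⊑-trans : ∀ σ {τ ρ} → τ ⊑ σ → ρ ⊑ τ → ρ ⊑ σ
⊑-trans [] (here refl) q = q
⊑-trans (x ∷ σ) p q with ∈-++⁻ (map (x ∷_) (sublists σ)) p
... | inj₂ τ⊑σ = ∈-++⁺ʳ (map (x ∷_) (sublists σ)) (⊑-trans σ τ⊑σ q)
... | inj₁ r with ∈-map⁻ (x ∷_) r
... | τ , τ⊑σ , refl with ∈-++⁻ (map (x ∷_) (sublists τ)) q
...   | inj₂ ρ⊑τ = ∈-++⁺ʳ (map (x ∷_) (sublists σ)) (⊑-trans σ τ⊑σ ρ⊑τ)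
...   | inj₁ s with ∈-map⁻ (x ∷_) s
...     | _ , ρ⊑τ , refl = ∈-++⁺ˡ (∈-map⁺ (x ∷_) (⊑-trans σ τ⊑σ ρ⊑τ))

∷ʳ-⊑ : ∀ σ k {τ} → τ ⊑ σ → τ ∷ʳ k ⊑ σ ∷ʳ k
∷ʳ-⊑ [] k (here refl) = here refl
∷ʳ-⊑ (x ∷ σ) k p with ∈-++⁻ (map (x ∷_) (sublists σ)) p
... | inj₂ τ⊑σ = ∈-++⁺ʳ (map (x ∷_) (sublists (σ ∷ʳ k))) (∷ʳ-⊑ σ k τ⊑σ)
... | inj₁ r with ∈-map⁻ (x ∷_) r
... | _ , τ⊑σ , refl = ∈-++⁺ˡ (∈-map⁺ (x ∷_) (∷ʳ-⊑ σ k τ⊑σ))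

⊑-∷ʳ⁻ : ∀ σ k {τ} → τ ⊑ σ ∷ʳ k → τ ⊑ σ ⊎ ∃ λ ρ → ρ ⊑ σ × τ ≡ ρ ∷ʳ k
⊑-∷ʳ⁻ [] k (here refl) = inj₂ ([] , here refl , refl)
⊑-∷ʳ⁻ [] k (there (here refl)) = inj₁ (here refl)
⊑-∷ʳ⁻ (x ∷ σ) k p with ∈-++⁻ (map (x ∷_) (sublists (σ ∷ʳ k))) p
... | inj₂ r with ⊑-∷ʳ⁻ σ k r
...   | inj₁ τ⊑σ = inj₁ (∈-++⁺ʳ (map (x ∷_) (sublists σ)) τ⊑σ)
...   | inj₂ (ρ , ρ⊑σ , refl) = inj₂ (ρ , ∈-++⁺ʳ (map (x ∷_) (sublists σ)) ρ⊑σ , refl)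
⊑-∷ʳ⁻ (x ∷ σ) k p | inj₁ r with ∈-map⁻ (x ∷_) r
... | _ , r′ , refl with ⊑-∷ʳ⁻ σ k r′
...   | inj₁ τ⊑σ = inj₁ (∈-++⁺ˡ (∈-map⁺ (x ∷_) τ⊑σ))
...   | inj₂ (ρ , ρ⊑σ , refl) = inj₂ (x ∷ ρ , ∈-++⁺ˡ (∈-map⁺ (x ∷_) ρ⊑σ) , refl)

sublists-Unique : ∀ σ → Unique σ → Unique (sublists σ)
sublists-Unique [] _ = [] ∷ []
sublists-Unique (x ∷ σ) (x∉σ ∷ σ!) =
  Unique.++⁺ (Unique.map⁺ ∷-injectiveʳ (sublists-Unique σ σ!)) (sublists-Unique σ σ!) disjoint
  where
  disjoint : Disjoint (map (x ∷_) (sublists σ)) (sublists σ)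
  disjoint (p , x∷τ⊑σ) with ∈-map⁻ (x ∷_) p
  ... | _ , _ , refl = All.lookup x∉σ (⊑-∈ σ x∷τ⊑σ (here refl)) refl

⊑-Unique : ∀ σ → Unique σ → ∀ {τ} → τ ⊑ σ → Unique τ
⊑-Unique [] _ (here refl) = []
⊑-Unique (x ∷ σ) (x∉σ ∷ σ!) p with ∈-++⁻ (map (x ∷_) (sublists σ)) p
... | inj₂ τ⊑σ = ⊑-Unique σ σ! τ⊑σ
... | inj₁ r with ∈-map⁻ (x ∷_) r
... | _ , τ⊑σ , refl =
  All.tabulate (λ y∈τ y≡x → All.lookup x∉σ (⊑-∈ σ τ⊑σ y∈τ) y≡x) ∷ ⊑-Unique σ σ! τ⊑σ

countLength : ℕ → List (List ℕ) → ℕ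
countLength k L = length (filter (λ σ → length σ ≟ k) L)

δ : ℕ → ℕ → ℕ
δ l k = if l ≡ᵇ k then 1 else 0

δ-refl : ∀ l → δ l l ≡ 1
δ-refl l with l ≡ᵇ l in eq
... | true = refl
... | false = ⊥-elim (subst T eq (≡⇒≡ᵇ l l refl))

δ-≢ : ∀ {l k} → l ≢ k → δ l k ≡ 0
δ-≢ {l} {k} l≢k with l ≡ᵇ k in eq
... | true = contradiction (≡ᵇ⇒≡ l k (subst T (sym eq) tt)) l≢k
... | false = refl

countLength-∷ : ∀ k σ S → countLength k (σ ∷ S) ≡ δ (length σ) k + countLength k S
countLength-∷ k σ S with length σ ≡ᵇ k
... | true = refl
... | false = refl

countLength-++ : ∀ k A B → countLength k (A ++ B) ≡ countLength k A + countLength k B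
countLength-++ k A B = trans (cong length (filter-++ (λ σ → length σ ≟ k) A B))
                             (length-++ (filter (λ σ → length σ ≟ k) A))

countLength-↭ : ∀ k {A B} → A ↭ B → countLength k A ≡ countLength k B
countLength-↭ k A↭B = ↭-length (filter-↭ (λ σ → length σ ≟ k) A↭B)

countLength-map-suc : ∀ (f : List ℕ → List ℕ) → (∀ τ → length (f τ) ≡ suc (length τ)) →
  ∀ k A → countLength (suc k) (map f A) ≡ countLength k A
countLength-map-suc f ∣f∣ k [] = refl
countLength-map-suc f ∣f∣ k (τ ∷ A) = begin
  countLength (suc k) (f τ ∷ map f A)                ≡⟨ countLength-∷ (suc k) (f τ) (map f A) ⟩
  δ (length (f τ)) (suc k) + countLength (suc k) (map f A)
    ≡⟨ cong₂ _+_ (cong (λ l → δ l (suc k)) (∣f∣ τ)) (countLength-map-suc f ∣f∣ k A) ⟩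
  δ (length τ) k + countLength k A                   ≡⟨ countLength-∷ k τ A ⟨
  countLength k (τ ∷ A)                              ∎

countLength-zero-map-∷ : ∀ (x : ℕ) A → countLength 0 (map (x ∷_) A) ≡ 0
countLength-zero-map-∷ x [] = refl
countLength-zero-map-∷ x (τ ∷ A) = countLength-zero-map-∷ x A

countLength-sublists : ∀ σ k → countLength k (sublists σ) ≡ length σ C k
countLength-sublists [] zero = refl
countLength-sublists [] (suc k) = refl
countLength-sublists (x ∷ σ) zero =
  trans (countLength-++ 0 (map (x ∷_) (sublists σ)) (sublists σ))
        (cong₂ _+_ (countLength-zero-map-∷ x (sublists σ)) (countLength-sublists σ 0))
countLength-sublists (x ∷ σ) (suc k) = begin
  countLength (suc k) (map (x ∷_) (sublists σ) ++ sublists σ)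
    ≡⟨ countLength-++ (suc k) (map (x ∷_) (sublists σ)) (sublists σ) ⟩
  countLength (suc k) (map (x ∷_) (sublists σ)) + countLength (suc k) (sublists σ)
    ≡⟨ cong₂ _+_ (countLength-map-suc (x ∷_) (λ _ → refl) k (sublists σ)) (countLength-sublists σ (suc k)) ⟩
  countLength k (sublists σ) + length σ C suc k
    ≡⟨ cong (_+ length σ C suc k) (countLength-sublists σ k) ⟩
  length σ C k + length σ C suc k
    ≡⟨ nCk+nC[k+1]≡[n+1]C[k+1] (length σ) k ⟩
  suc (length σ) C suc k ∎

countLength-tooLong : ∀ {B l} → B < l → ∀ S → All (λ σ → length σ ≤ B) S → countLength l S ≡ 0
countLength-tooLong B<l [] [] = refl
countLength-tooLong {l = l} B<l (σ ∷ S) (∣σ∣≤B ∷ S≤B) = trans (countLength-∷ l σ S)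
  (cong₂ _+_ (δ-≢ (<⇒≢ (≤-<-trans ∣σ∣≤B B<l))) (countLength-tooLong B<l S S≤B))

∑≤ : ℕ → (ℕ → ℕ) → ℕ
∑≤ zero g = g 0
∑≤ (suc j) g = ∑≤ j g + g (suc j)

∑≤-cong : ∀ j {f g : ℕ → ℕ} → (∀ t → f t ≡ g t) → ∑≤ j f ≡ ∑≤ j g
∑≤-cong zero f≗g = f≗g 0
∑≤-cong (suc j) f≗g = cong₂ _+_ (∑≤-cong j f≗g) (f≗g (suc j))

∑≤-+ : ∀ j (f g : ℕ → ℕ) → ∑≤ j (λ t → f t + g t) ≡ ∑≤ j f + ∑≤ j g
∑≤-+ zero f g = refl
∑≤-+ (suc j) f g = begin
  ∑≤ j (λ t → f t + g t) + (f (suc j) + g (suc j)) ≡⟨ cong (_+ (f (suc j) + g (suc j))) (∑≤-+ j f g) ⟩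
  (∑≤ j f + ∑≤ j g) + (f (suc j) + g (suc j))     ≡⟨ +-interchange (∑≤ j f) (∑≤ j g) (f (suc j)) (g (suc j)) ⟩
  (∑≤ j f + f (suc j)) + (∑≤ j g + g (suc j))     ∎

∑≤-zero : ∀ j (g : ℕ → ℕ) → (∀ {t} → t ≤ j → g t ≡ 0) → ∑≤ j g ≡ 0
∑≤-zero zero g g≡0 = g≡0 z≤n
∑≤-zero (suc j) g g≡0 = cong₂ _+_ (∑≤-zero j g (g≡0 ∘ m≤n⇒m≤1+n)) (g≡0 ≤-refl)

module _ (f : ℕ → ℕ) (d : ℕ) (f-below : ∀ {l} → l < d → f l ≡ 0) where

  δ-expansion : ∀ j {l} → l ≤ j + d → f l ≡ ∑≤ j (λ t → δ l (t + d) * f (t + d))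
  δ-expansion zero {l} l≤d with m≤n⇒m<n∨m≡n l≤d
  ... | inj₂ refl = sym (trans (cong (_* f l) (δ-refl l)) (*-identityˡ (f l)))
  ... | inj₁ l<d = trans (f-below l<d) (sym (cong (_* f d) (δ-≢ (<⇒≢ l<d))))
  δ-expansion (suc j) {l} l≤ with m≤n⇒m<n∨m≡n l≤
  ... | inj₂ refl = sym (begin
    ∑≤ j (λ t → δ l (t + d) * f (t + d)) + δ l l * f l
      ≡⟨ cong₂ _+_ (∑≤-zero j _ (λ t≤j → cong (_* _) (δ-≢ (>⇒≢ (s≤s (+-monoˡ-≤ d t≤j))))))
                   (cong (_* f l) (δ-refl l)) ⟩
    0 + 1 * f l ≡⟨ *-identityˡ (f l) ⟩
    f l ∎)
  ... | inj₁ (s≤s l≤j+d) = begin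
    f l                                       ≡⟨ δ-expansion j l≤j+d ⟩
    ∑≤ j (λ t → δ l (t + d) * f (t + d))       ≡⟨ +-identityʳ _ ⟨
    ∑≤ j (λ t → δ l (t + d) * f (t + d)) + 0   ≡⟨ cong (λ z → ∑≤ j _ + z * f (suc j + d)) (δ-≢ (<⇒≢ (s≤s l≤j+d))) ⟨
    ∑≤ j (λ t → δ l (t + d) * f (t + d)) + δ l (suc j + d) * f (suc j + d) ∎

  sum-map-length : ∀ j S → All (λ σ → length σ ≤ j + d) S →
    sum (map (f ∘ length) S) ≡ ∑≤ j (λ t → countLength (t + d) S * f (t + d))
  sum-map-length j [] [] = sym (∑≤-zero j _ (λ _ → refl))
  sum-map-length j (σ ∷ S) (∣σ∣≤ ∷ S≤) = begin
    f (length σ) + sum (map (f ∘ length) S)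
      ≡⟨ cong₂ _+_ (δ-expansion j ∣σ∣≤) (sum-map-length j S S≤) ⟩
    ∑≤ j (λ t → δ (length σ) (t + d) * f (t + d)) + ∑≤ j (λ t → countLength (t + d) S * f (t + d))
      ≡⟨ ∑≤-+ j _ _ ⟨
    ∑≤ j (λ t → δ (length σ) (t + d) * f (t + d) + countLength (t + d) S * f (t + d))
      ≡⟨ ∑≤-cong j (λ t → trans (cong (_* f (t + d)) (countLength-∷ (t + d) σ S))
                                (*-distribʳ-+ (f (t + d)) (δ (length σ) (t + d)) _)) ⟨
    ∑≤ j (λ t → countLength (t + d) (σ ∷ S) * f (t + d)) ∎

-- Unlike coneAll, only the simplices through the new vertices, each listed once, so that
-- step (S , m) is a permutation of S ++ newSimplices m S.
newSimplices : ℕ → List Simplex → List Simplex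
newSimplices w [] = []
newSimplices w (σ ∷ S) = map (_∷ʳ w) (sublists σ) ++ newSimplices (suc w) S

record NewSimplex (w₀ : ℕ) (S : List Simplex) (τ : Simplex) : Set where
  field
    σ : Simplex
    w : ℕ
    ρ : Simplex
    σ∈S : σ ∈ S
    w₀≤w : w₀ ≤ w
    w<w₀+∣S∣ : w < w₀ + length S
    ρ⊑σ : ρ ⊑ σ
    τ≡ρ∷ʳw : τ ≡ ρ ∷ʳ w
    cone⊆new : ∀ {ρ′} → ρ′ ⊑ σ → ρ′ ∷ʳ w ∈ newSimplices w₀ S

∈-newSimplices⁻ : ∀ w₀ S {τ} → τ ∈ newSimplices w₀ S → NewSimplex w₀ S τ
∈-newSimplices⁻ w₀ (σ ∷ S) p with ∈-++⁻ (map (_∷ʳ w₀) (sublists σ)) p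
... | inj₁ q with ∈-map⁻ (_∷ʳ w₀) q
...   | ρ , ρ⊑σ , τ≡ρ∷ʳw₀ = record
  { σ = σ ; w = w₀ ; ρ = ρ ; σ∈S = here refl ; w₀≤w = ≤-refl
  ; w<w₀+∣S∣ = m<m+n w₀ (s≤s z≤n) ; ρ⊑σ = ρ⊑σ ; τ≡ρ∷ʳw = τ≡ρ∷ʳw₀
  ; cone⊆new = ∈-++⁺ˡ ∘ ∈-map⁺ (_∷ʳ w₀) }
∈-newSimplices⁻ w₀ (σ ∷ S) p | inj₂ q = record
  { σ = σ′ ; w = w ; ρ = ρ ; σ∈S = there σ∈S ; w₀≤w = ≤-trans (n≤1+n w₀) w₀≤w
  ; w<w₀+∣S∣ = subst (w <_) (sym (+-suc w₀ (length S))) w<w₀+∣S∣ ; ρ⊑σ = ρ⊑σ ; τ≡ρ∷ʳw = τ≡ρ∷ʳw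
  ; cone⊆new = ∈-++⁺ʳ (map (_∷ʳ w₀) (sublists σ)) ∘ cone⊆new }
  where open NewSimplex (∈-newSimplices⁻ (suc w₀) S q) renaming (σ to σ′)

newSimplices-Unique : ∀ w₀ S → All Unique S → Unique (newSimplices w₀ S)
newSimplices-Unique w₀ [] [] = []
newSimplices-Unique w₀ (σ ∷ S) (σ! ∷ S!) =
  Unique.++⁺ (Unique.map⁺ (∷ʳ-injectiveˡ _ _) (sublists-Unique σ σ!))
             (newSimplices-Unique (suc w₀) S S!) disjoint
  where
  disjoint : Disjoint (map (_∷ʳ w₀) (sublists σ)) (newSimplices (suc w₀) S)
  disjoint (p , q) with ∈-map⁻ (_∷ʳ w₀) p
  ... | ρ₀ , _ , refl = <⇒≢ w₀≤w (∷ʳ-injectiveʳ ρ₀ ρ τ≡ρ∷ʳw)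
    where open NewSimplex (∈-newSimplices⁻ (suc w₀) S q)

coneAll⊆ : ∀ w₀ S {T} → (∀ {σ τ} → σ ∈ S → τ ⊑ σ → NonNil τ → τ ∈ T) →
  ∀ {τ} → τ ∈ coneAll w₀ S → τ ∈ T ⊎ τ ∈ newSimplices w₀ S
coneAll⊆ w₀ (σ ∷ S) faces∈T p with ∈-++⁻ (faces (σ ∷ʳ w₀)) p
... | inj₁ q with ∈-filter⁻ nonNil? q
...   | τ⊑σ∷ʳw₀ , τ≢[] with ⊑-∷ʳ⁻ σ w₀ τ⊑σ∷ʳw₀
...     | inj₁ τ⊑σ = inj₁ (faces∈T (here refl) τ⊑σ τ≢[])
...     | inj₂ (ρ , ρ⊑σ , refl) = inj₂ (∈-++⁺ˡ (∈-map⁺ (_∷ʳ w₀) ρ⊑σ))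
coneAll⊆ w₀ (σ ∷ S) faces∈T p | inj₂ q with coneAll⊆ (suc w₀) S (faces∈T ∘ there) q
... | inj₁ τ∈T = inj₁ τ∈T
... | inj₂ τ∈new = inj₂ (∈-++⁺ʳ (map (_∷ʳ w₀) (sublists σ)) τ∈new)

NonNil-∷ʳ : ∀ (ρ : List ℕ) w → NonNil (ρ ∷ʳ w)
NonNil-∷ʳ [] w = tt
NonNil-∷ʳ (_ ∷ _) w = tt

newSimplices⊆coneAll : ∀ w₀ S {τ} → τ ∈ newSimplices w₀ S → τ ∈ coneAll w₀ S
newSimplices⊆coneAll w₀ (σ ∷ S) p with ∈-++⁻ (map (_∷ʳ w₀) (sublists σ)) p
... | inj₁ q with ∈-map⁻ (_∷ʳ w₀) q
...   | ρ , ρ⊑σ , refl = ∈-++⁺ˡ (∈-filter⁺ nonNil? (∷ʳ-⊑ σ w₀ ρ⊑σ) (NonNil-∷ʳ ρ w₀))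
newSimplices⊆coneAll w₀ (σ ∷ S) p | inj₂ q =
  ∈-++⁺ʳ (faces (σ ∷ʳ w₀)) (newSimplices⊆coneAll (suc w₀) S q)

length-∷ʳ : ∀ (ρ : List ℕ) w → length (ρ ∷ʳ w) ≡ suc (length ρ)
length-∷ʳ ρ w = trans (length-++ ρ) (+-comm (length ρ) 1)

countLength-newSimplices : ∀ d w₀ S →
  countLength (suc d) (newSimplices w₀ S) ≡ sum (map (λ σ → length σ C d) S)
countLength-newSimplices d w₀ [] = refl
countLength-newSimplices d w₀ (σ ∷ S) = begin
  countLength (suc d) (map (_∷ʳ w₀) (sublists σ) ++ newSimplices (suc w₀) S)
    ≡⟨ countLength-++ (suc d) (map (_∷ʳ w₀) (sublists σ)) (newSimplices (suc w₀) S) ⟩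
  countLength (suc d) (map (_∷ʳ w₀) (sublists σ)) + countLength (suc d) (newSimplices (suc w₀) S)
    ≡⟨ cong₂ _+_ (countLength-map-suc (_∷ʳ w₀) (λ ρ → length-∷ʳ ρ w₀) d (sublists σ))
                 (countLength-newSimplices d (suc w₀) S) ⟩
  countLength d (sublists σ) + sum (map (λ σ → length σ C d) S)
    ≡⟨ cong (_+ sum (map (λ σ → length σ C d) S)) (countLength-sublists σ d) ⟩
  length σ C d + sum (map (λ σ → length σ C d) S) ∎

newSimplices-length : ∀ {B} w₀ S → All (λ σ → length σ ≤ B) S →
  ∀ {τ} → τ ∈ newSimplices w₀ S → length τ ≤ suc B
newSimplices-length w₀ S S≤B τ∈new with ∈-newSimplices⁻ w₀ S τ∈new
... | record { σ = σ ; w = w ; ρ = ρ ; σ∈S = σ∈S ; ρ⊑σ = ρ⊑σ ; τ≡ρ∷ʳw = refl } =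
  subst (_≤ _) (sym (length-∷ʳ ρ w)) (s≤s (≤-trans (⊑-length σ ρ⊑σ) (All.lookup S≤B σ∈S)))

record IsComplex (S : List Simplex) (m : ℕ) : Set where
  field
    unique : Unique S
    vertices<m : All (All (_< m)) S
    simplexUnique : All Unique S
    faceClosed : ∀ {σ τ} → σ ∈ S → τ ⊑ σ → NonNil τ → τ ∈ S

module Step {S m} (isComplex : IsComplex S m) where
  open IsComplex isComplex

  S′ : List Simplex
  S′ = proj₁ (step (S , m))

  m′ : ℕ
  m′ = m + length S

  vertex<m : ∀ {σ x} → σ ∈ S → x ∈ σ → x < m
  vertex<m σ∈S = All.lookup (All.lookup vertices<m σ∈S)

  newSimplices-fresh : ∀ {τ} → τ ∈ newSimplices m S → τ ∉ S
  newSimplices-fresh τ∈new τ∈S with ∈-newSimplices⁻ m S τ∈new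
  ... | record { ρ = ρ ; w = w ; w₀≤w = m≤w ; τ≡ρ∷ʳw = refl } =
    <⇒≱ (vertex<m τ∈S (∈-++⁺ʳ ρ (here refl))) m≤w

  step-↭ : S′ ↭ S ++ newSimplices m S
  step-↭ = ∼bag⇒↭ (unique∧set⇒bag (deduplicate-! (S ++ coneAll m S)) unique-S++new (mk⇔ ⊆S++new S++new⊆))
    where
    unique-S++new : Unique (S ++ newSimplices m S)
    unique-S++new = Unique.++⁺ unique (newSimplices-Unique m S simplexUnique)
                               (λ (τ∈S , τ∈new) → newSimplices-fresh τ∈new τ∈S)

    ⊆S++new : ∀ {τ} → τ ∈ S′ → τ ∈ S ++ newSimplices m S
    ⊆S++new p with ∈-++⁻ S (∈-deduplicate⁻ (≡-dec _≟_) (S ++ coneAll m S) p)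
    ... | inj₁ τ∈S = ∈-++⁺ˡ τ∈S
    ... | inj₂ τ∈cone with coneAll⊆ m S faceClosed τ∈cone
    ...   | inj₁ τ∈S = ∈-++⁺ˡ τ∈S
    ...   | inj₂ τ∈new = ∈-++⁺ʳ S τ∈new

    S++new⊆ : ∀ {τ} → τ ∈ S ++ newSimplices m S → τ ∈ S′
    S++new⊆ p with ∈-++⁻ S p
    ... | inj₁ τ∈S = ∈-deduplicate⁺ (≡-dec _≟_) (∈-++⁺ˡ τ∈S)
    ... | inj₂ τ∈new = ∈-deduplicate⁺ (≡-dec _≟_) (∈-++⁺ʳ S (newSimplices⊆coneAll m S τ∈new))

  All-S′ : ∀ {P : Simplex → Set} → (∀ {σ} → σ ∈ S → P σ) → (∀ {τ} → τ ∈ newSimplices m S → P τ) →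
    All P S′
  All-S′ onS onNew = All.tabulate (λ τ∈S′ → Sum.[ onS , onNew ] (∈-++⁻ S (∈-resp-↭ step-↭ τ∈S′)))

  ∈-S′ : ∀ {τ} → τ ∈ S ++ newSimplices m S → τ ∈ S′
  ∈-S′ = ∈-resp-↭ (↭-sym step-↭)

  step-isComplex : IsComplex S′ m′
  step-isComplex = record
    { unique = deduplicate-! (S ++ coneAll m S)
    ; vertices<m = All-S′ (All.map (λ x<m → <-≤-trans x<m (m≤m+n m _)) ∘ All.lookup vertices<m) new-vertices<m′
    ; simplexUnique = All-S′ (All.lookup simplexUnique) new-Unique
    ; faceClosed = faceClosed′
    }
    where
    new-vertices<m′ : ∀ {τ} → τ ∈ newSimplices m S → All (_< m′) τ
    new-vertices<m′ τ∈new with ∈-newSimplices⁻ m S τ∈new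
    ... | record { σ = σ ; ρ = ρ ; σ∈S = σ∈S ; ρ⊑σ = ρ⊑σ ; w<w₀+∣S∣ = w<m′ ; τ≡ρ∷ʳw = refl } =
      All.++⁺ (All.tabulate (λ x∈ρ → <-≤-trans (vertex<m σ∈S (⊑-∈ σ ρ⊑σ x∈ρ)) (m≤m+n m _))) (w<m′ ∷ [])

    new-Unique : ∀ {τ} → τ ∈ newSimplices m S → Unique τ
    new-Unique τ∈new with ∈-newSimplices⁻ m S τ∈new
    ... | record { σ = σ ; ρ = ρ ; σ∈S = σ∈S ; ρ⊑σ = ρ⊑σ ; w₀≤w = m≤w ; τ≡ρ∷ʳw = refl } =
      Unique.++⁺ (⊑-Unique σ (All.lookup simplexUnique σ∈S) ρ⊑σ) ([] ∷ [])
        (λ { (x∈ρ , here refl) → <⇒≱ (vertex<m σ∈S (⊑-∈ σ ρ⊑σ x∈ρ)) m≤w })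

    faceClosed′ : ∀ {σ τ} → σ ∈ S′ → τ ⊑ σ → NonNil τ → τ ∈ S′
    faceClosed′ σ∈S′ τ⊑σ τ≢[] with ∈-++⁻ S (∈-resp-↭ step-↭ σ∈S′)
    ... | inj₁ σ∈S = ∈-S′ (∈-++⁺ˡ (faceClosed σ∈S τ⊑σ τ≢[]))
    ... | inj₂ σ∈new with ∈-newSimplices⁻ m S σ∈new
    ...   | record { σ = σ₀ ; ρ = ρ ; w = w ; σ∈S = σ₀∈S ; ρ⊑σ = ρ⊑σ₀ ; cone⊆new = cone⊆new ; τ≡ρ∷ʳw = refl }
          with ⊑-∷ʳ⁻ ρ w τ⊑σ
    ...     | inj₁ τ⊑ρ = ∈-S′ (∈-++⁺ˡ (faceClosed σ₀∈S (⊑-trans σ₀ ρ⊑σ₀ τ⊑ρ) τ≢[]))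
    ...     | inj₂ (ρ′ , ρ′⊑ρ , refl) = ∈-S′ (∈-++⁺ʳ S (cone⊆new (⊑-trans σ₀ ρ⊑σ₀ ρ′⊑ρ)))

K-isComplex : ∀ n → IsComplex (simplices n) (proj₂ (K n))
K-isComplex zero = record
  { unique = [] ∷ []
  ; vertices<m = (s≤s z≤n ∷ []) ∷ []
  ; simplexUnique = ([] ∷ []) ∷ []
  ; faceClosed = λ { (here refl) (here refl) _ → here refl ; (here refl) (there (here refl)) () }
  }
K-isComplex (suc n) = Step.step-isComplex (K-isComplex n)

K-length : ∀ n → All (λ σ → length σ ≤ suc n) (simplices n)
K-length zero = s≤s z≤n ∷ []
K-length (suc n) = Step.All-S′ (K-isComplex n)
  (m≤n⇒m≤1+n ∘ All.lookup (K-length n)) (newSimplices-length _ (simplices n) (K-length n))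

N-step : ∀ d n → N d (suc n) ≡ N d n + sum (map (λ σ → length σ C d) (simplices n))
N-step d n = begin
  N d (suc n)                                                   ≡⟨ countLength-↭ (suc d) (Step.step-↭ (K-isComplex n)) ⟩
  countLength (suc d) (simplices n ++ newSimplices _ (simplices n)) ≡⟨ countLength-++ (suc d) (simplices n) _ ⟩
  N d n + countLength (suc d) (newSimplices _ (simplices n))      ≡⟨ cong (N d n +_) (countLength-newSimplices d _ (simplices n)) ⟩
  N d n + sum (map (λ σ → length σ C d) (simplices n))            ∎

N-above : ∀ n → N (suc n) n ≡ 0
N-above n = countLength-tooLong ≤-refl (simplices n) (K-length n)

N-suc : ∀ j m → N (suc m) (suc (j + m)) ≡
  N (suc m) (j + m) + ∑≤ j (λ t → N (t + m) (j + m) * (suc (t + m) C suc m))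
N-suc j m = begin
  N (suc m) (suc (j + m))
    ≡⟨ N-step (suc m) (j + m) ⟩
  N (suc m) (j + m) + sum (map (λ σ → length σ C suc m) S)
    ≡⟨ cong (N (suc m) (j + m) +_) (sum-map-length (_C suc m) (suc m) k>n⇒nCk≡0 j S lengths≤) ⟩
  N (suc m) (j + m) + ∑≤ j (λ t → countLength (t + suc m) S * ((t + suc m) C suc m))
    ≡⟨ cong (N (suc m) (j + m) +_) (∑≤-cong j (λ t → cong (λ l → countLength l S * (l C suc m)) (+-suc t m))) ⟩
  N (suc m) (j + m) + ∑≤ j (λ t → N (t + m) (j + m) * (suc (t + m) C suc m)) ∎
  where
  S : List Simplex
  S = simplices (j + m)
  lengths≤ : All (λ σ → length σ ≤ j + suc m) S
  lengths≤ = subst (λ B → All (λ σ → length σ ≤ B) S) (sym (+-suc j m)) (K-length (j + m))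

[t+n]Cn≡[t+n]Ct : ∀ t n → (t + n) C n ≡ (t + n) C t
[t+n]Cn≡[t+n]Ct t n = trans (nCk≡nC[n∸k] (m≤n+m n t)) (cong ((t + n) C_) (m+n∸n≡m t n))

2*[2+n]C2≡[2+n]*[1+n] : ∀ n → 2 * ((2 + n) C 2) ≡ (2 + n) * (1 + n)
2*[2+n]C2≡[2+n]*[1+n] zero = refl
2*[2+n]C2≡[2+n]*[1+n] (suc n) = begin
  2 * ((3 + n) C 2)                   ≡⟨ cong (2 *_) (nCk+nC[k+1]≡[n+1]C[k+1] (2 + n) 1) ⟨
  2 * ((2 + n) C 1 + (2 + n) C 2)     ≡⟨ cong (λ x → 2 * (x + (2 + n) C 2)) (nC1≡n (2 + n)) ⟩
  2 * ((2 + n) + (2 + n) C 2)         ≡⟨ *-distribˡ-+ 2 (2 + n) ((2 + n) C 2) ⟩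
  2 * (2 + n) + 2 * ((2 + n) C 2)     ≡⟨ cong (2 * (2 + n) +_) (2*[2+n]C2≡[2+n]*[1+n] n) ⟩
  2 * (2 + n) + (2 + n) * (1 + n)     ≡⟨ solve [ n ] ⟩
  (3 + n) * (2 + n)                   ∎

6*[3+n]C3≡[3+n]*[2+n]*[1+n] : ∀ n → 6 * ((3 + n) C 3) ≡ (3 + n) * (2 + n) * (1 + n)
6*[3+n]C3≡[3+n]*[2+n]*[1+n] zero = refl
6*[3+n]C3≡[3+n]*[2+n]*[1+n] (suc n) = begin
  6 * ((4 + n) C 3)                             ≡⟨ cong (6 *_) (nCk+nC[k+1]≡[n+1]C[k+1] (3 + n) 2) ⟨
  6 * ((3 + n) C 2 + (3 + n) C 3)               ≡⟨ *-distribˡ-+ 6 ((3 + n) C 2) ((3 + n) C 3) ⟩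
  6 * ((3 + n) C 2) + 6 * ((3 + n) C 3)         ≡⟨ cong (_+ 6 * ((3 + n) C 3)) (*-assoc 3 2 ((3 + n) C 2)) ⟩
  3 * (2 * ((3 + n) C 2)) + 6 * ((3 + n) C 3)
    ≡⟨ cong₂ (λ x y → 3 * x + y) (2*[2+n]C2≡[2+n]*[1+n] (suc n)) (6*[3+n]C3≡[3+n]*[2+n]*[1+n] n) ⟩
  3 * ((3 + n) * (2 + n)) + (3 + n) * (2 + n) * (1 + n) ≡⟨ solve [ n ] ⟩
  (4 + n) * (3 + n) * (2 + n)                   ∎

[1+n]Cn≡1+n : ∀ n → (1 + n) C n ≡ 1 + n
[1+n]Cn≡1+n n = trans ([t+n]Cn≡[t+n]Ct 1 n) (nC1≡n (1 + n))

2*[2+n]Cn≡[2+n]*[1+n] : ∀ n → 2 * ((2 + n) C n) ≡ (2 + n) * (1 + n)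
2*[2+n]Cn≡[2+n]*[1+n] n = trans (cong (2 *_) ([t+n]Cn≡[t+n]Ct 2 n)) (2*[2+n]C2≡[2+n]*[1+n] n)

6*[3+n]Cn≡[3+n]*[2+n]*[1+n] : ∀ n → 6 * ((3 + n) C n) ≡ (3 + n) * (2 + n) * (1 + n)
6*[3+n]Cn≡[3+n]*[2+n]*[1+n] n = trans (cong (6 *_) ([t+n]Cn≡[t+n]Ct 3 n)) (6*[3+n]C3≡[3+n]*[2+n]*[1+n] n)

N-top : ∀ n → N n n ≡ 1
N-top zero = refl
N-top (suc n) = begin
  N (suc n) (suc n)                       ≡⟨ N-suc 0 n ⟩
  N (suc n) n + N n n * (suc n C suc n)   ≡⟨ cong₂ (λ x y → x + y * (suc n C suc n)) (N-above n) (N-top n) ⟩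
  0 + 1 * (suc n C suc n)                 ≡⟨ trans (*-identityˡ _) (nCn≡1 (suc n)) ⟩
  1                                       ∎

N-codim1 : ∀ m → 2 * N m (1 + m) ≡ (1 + m) * (1 + m + 3)
N-codim1 zero = refl
N-codim1 (suc m)
  rewrite N-suc 1 m | N-top (suc m) | nCn≡1 (suc m) | [1+n]Cn≡1+n (suc m) = begin
  2 * (1 + (N m (1 + m) * 1 + 1 * (2 + m)))  ≡⟨ regroup (N m (1 + m)) m ⟩
  2 * N m (1 + m) + 2 * (3 + m)              ≡⟨ cong (_+ 2 * (3 + m)) (N-codim1 m) ⟩
  (1 + m) * (1 + m + 3) + 2 * (3 + m)        ≡⟨ solve [ m ] ⟩
  (2 + m) * (2 + m + 3)                      ∎
  where
  regroup : ∀ a m → 2 * (1 + (a * 1 + 1 * (2 + m))) ≡ 2 * a + 2 * (3 + m)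
  regroup = solve-∀

N-codim2 : ∀ m → 24 * N m (2 + m) ≡ (2 + m) * (1 + m) * ((2 + m + 1) * (3 * (2 + m) + 14))
N-codim2 zero = refl
N-codim2 (suc m)
  rewrite N-suc 2 m | nCn≡1 (suc m) | [1+n]Cn≡1+n (suc m) | N-top (2 + m) = begin
  24 * (a₁ + ((a₂ * 1 + a₁ * (2 + m)) + 1 * c))
    ≡⟨ regroup a₁ a₂ c m ⟩
  12 * (3 + m) * (2 * a₁) + 24 * a₂ + 12 * (2 * c)
    ≡⟨ cong₂ (λ x y → 12 * (3 + m) * x + y + 12 * (2 * c)) (N-codim1 (suc m)) (N-codim2 m) ⟩
  12 * (3 + m) * ((2 + m) * (2 + m + 3)) + (2 + m) * (1 + m) * ((2 + m + 1) * (3 * (2 + m) + 14)) + 12 * (2 * c)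
    ≡⟨ cong (λ z → 12 * (3 + m) * ((2 + m) * (2 + m + 3)) + (2 + m) * (1 + m) * ((2 + m + 1) * (3 * (2 + m) + 14))
                   + 12 * z)
            (2*[2+n]Cn≡[2+n]*[1+n] (suc m)) ⟩
  12 * (3 + m) * ((2 + m) * (2 + m + 3)) + (2 + m) * (1 + m) * ((2 + m + 1) * (3 * (2 + m) + 14))
    + 12 * ((3 + m) * (2 + m))
    ≡⟨ solve [ m ] ⟩
  (3 + m) * (2 + m) * ((3 + m + 1) * (3 * (3 + m) + 14)) ∎
  where
  a₁ a₂ c : ℕ
  a₁ = N (suc m) (2 + m)
  a₂ = N m (2 + m)
  c = (3 + m) C suc m
  regroup : ∀ a₁ a₂ c m → 24 * (a₁ + ((a₂ * 1 + a₁ * (2 + m)) + 1 * c))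
                        ≡ 12 * (3 + m) * (2 * a₁) + 24 * a₂ + 12 * (2 * c)
  regroup = solve-∀

-- m³ + 17m² + 86m + 128 is n³ + 8n² + 11n − 4 at n = m + 3.
N-codim3 : ∀ m → 48 * N m (3 + m) ≡ (3 + m) * (2 + m) * (1 + m) * (m * m * m + 17 * m * m + 86 * m + 128)
N-codim3 zero = refl
N-codim3 (suc m)
  rewrite N-suc 3 m | nCn≡1 (suc m) | [1+n]Cn≡1+n (suc m) | N-top (3 + m) = begin
  48 * (a₂ + (((a₃ * 1 + a₂ * (2 + m)) + a₁ * c₂) + 1 * c₃))
    ≡⟨ regroup a₁ a₂ a₃ c₂ c₃ m ⟩
  2 * (3 + m) * (24 * a₂) + 48 * a₃ + 12 * (2 * a₁) * (2 * c₂) + 8 * (6 * c₃)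
    ≡⟨ cong₂ (λ x y → 2 * (3 + m) * x + y + 12 * (2 * a₁) * (2 * c₂) + 8 * (6 * c₃))
             (N-codim2 (suc m)) (N-codim3 m) ⟩
  2 * (3 + m) * p₂ + p₃ + 12 * (2 * a₁) * (2 * c₂) + 8 * (6 * c₃)
    ≡⟨ cong₂ (λ x y → 2 * (3 + m) * p₂ + p₃ + 12 * x * y + 8 * (6 * c₃))
             (N-codim1 (2 + m)) (2*[2+n]Cn≡[2+n]*[1+n] (suc m)) ⟩
  2 * (3 + m) * p₂ + p₃ + 12 * ((3 + m) * (3 + m + 3)) * ((3 + m) * (2 + m)) + 8 * (6 * c₃)
    ≡⟨ cong (λ z → 2 * (3 + m) * p₂ + p₃ + 12 * ((3 + m) * (3 + m + 3)) * ((3 + m) * (2 + m)) + 8 * z)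
            (6*[3+n]Cn≡[3+n]*[2+n]*[1+n] (suc m)) ⟩
  2 * (3 + m) * p₂ + p₃ + 12 * ((3 + m) * (3 + m + 3)) * ((3 + m) * (2 + m))
    + 8 * ((4 + m) * (3 + m) * (2 + m))
    ≡⟨ expand m ⟩
  (4 + m) * (3 + m) * (2 + m) * ((1 + m) * (1 + m) * (1 + m) + 17 * (1 + m) * (1 + m) + 86 * (1 + m) + 128) ∎
  where
  a₁ a₂ a₃ c₂ c₃ p₂ p₃ : ℕ
  a₁ = N (2 + m) (3 + m)
  a₂ = N (suc m) (3 + m)
  a₃ = N m (3 + m)
  c₂ = (3 + m) C suc m
  c₃ = (4 + m) C suc m
  p₂ = (3 + m) * (2 + m) * ((3 + m + 1) * (3 * (3 + m) + 14))
  p₃ = (3 + m) * (2 + m) * (1 + m) * (m * m * m + 17 * m * m + 86 * m + 128)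
  regroup : ∀ a₁ a₂ a₃ c₂ c₃ m → 48 * (a₂ + (((a₃ * 1 + a₂ * (2 + m)) + a₁ * c₂) + 1 * c₃))
                              ≡ 2 * (3 + m) * (24 * a₂) + 48 * a₃ + 12 * (2 * a₁) * (2 * c₂) + 8 * (6 * c₃)
  regroup = solve-∀
  expand : ∀ m →
    2 * (3 + m) * ((3 + m) * (2 + m) * ((3 + m + 1) * (3 * (3 + m) + 14)))
      + (3 + m) * (2 + m) * (1 + m) * (m * m * m + 17 * m * m + 86 * m + 128)
      + 12 * ((3 + m) * (3 + m + 3)) * ((3 + m) * (2 + m)) + 8 * ((4 + m) * (3 + m) * (2 + m))
    ≡ (4 + m) * (3 + m) * (2 + m) * ((1 + m) * (1 + m) * (1 + m) + 17 * (1 + m) * (1 + m) + 86 * (1 + m) + 128)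
  expand = solve-∀

mainTheorem6 : ((n : ℕ) → N n n ≡ 1)
    × ((n : ℕ) → 1 ≤ n → 2 * N (n ∸ 1) n ≡ (n C 1) * (n + 3))
    × ((n : ℕ) → 2 ≤ n → 12 * N (n ∸ 2) n ≡ (n C 2) * ((n + 1) * (3 * n + 14)))
    × ((n : ℕ) → 3 ≤ n → 8 * N (n ∸ 3) n ≡ (n C 3) * (n ^ 3 + 8 * n ^ 2 + 11 * n ∸ 4))
mainTheorem6 = N-top , codim1 , codim2 , codim3
  where
  codim1 : (n : ℕ) → 1 ≤ n → 2 * N (n ∸ 1) n ≡ (n C 1) * (n + 3)
  codim1 (suc m) _ = trans (N-codim1 m) (cong (_* (suc m + 3)) (sym (nC1≡n (suc m))))

  codim2 : (n : ℕ) → 2 ≤ n → 12 * N (n ∸ 2) n ≡ (n C 2) * ((n + 1) * (3 * n + 14))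
  codim2 (suc zero) (s≤s ())
  codim2 (suc (suc m)) _ = *-cancelˡ-≡ _ _ 2 (begin
    2 * (12 * N m (2 + m))  ≡⟨ *-assoc 2 12 (N m (2 + m)) ⟨
    24 * N m (2 + m)        ≡⟨ N-codim2 m ⟩
    (2 + m) * (1 + m) * P   ≡⟨ cong (_* P) (2*[2+n]C2≡[2+n]*[1+n] m) ⟨
    2 * ((2 + m) C 2) * P   ≡⟨ *-assoc 2 ((2 + m) C 2) P ⟩
    2 * (((2 + m) C 2) * P) ∎)
    where
    P : ℕ
    P = (2 + m + 1) * (3 * (2 + m) + 14)

  codim3 : (n : ℕ) → 3 ≤ n → 8 * N (n ∸ 3) n ≡ (n C 3) * (n ^ 3 + 8 * n ^ 2 + 11 * n ∸ 4)
  codim3 (suc zero) (s≤s ())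
  codim3 (suc (suc zero)) (s≤s (s≤s ()))
  codim3 (suc (suc (suc m))) _ = *-cancelˡ-≡ _ _ 6 (begin
    6 * (8 * N m (3 + m))          ≡⟨ *-assoc 6 8 (N m (3 + m)) ⟨
    48 * N m (3 + m)               ≡⟨ N-codim3 m ⟩
    (3 + m) * (2 + m) * (1 + m) * Q
      ≡⟨ cong₂ _*_ (6*[3+n]C3≡[3+n]*[2+n]*[1+n] m) (m+n∸n≡m Q 4) ⟨
    6 * ((3 + m) C 3) * (Q + 4 ∸ 4) ≡⟨ cong (λ x → 6 * ((3 + m) C 3) * (x ∸ 4)) (expand m) ⟨
    6 * ((3 + m) C 3) * (n ^ 3 + 8 * n ^ 2 + 11 * n ∸ 4) ≡⟨ *-assoc 6 ((3 + m) C 3) _ ⟩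
    6 * (((3 + m) C 3) * (n ^ 3 + 8 * n ^ 2 + 11 * n ∸ 4)) ∎)
    where
    n Q : ℕ
    n = 3 + m
    Q = m * m * m + 17 * m * m + 86 * m + 128
    expand : ∀ m → (3 + m) * ((3 + m) * ((3 + m) * 1)) + 8 * ((3 + m) * ((3 + m) * 1)) + 11 * (3 + m)
                 ≡ m * m * m + 17 * m * m + 86 * m + 128 + 4
    expand = solve-∀
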